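{- For all $a\in\mathcal{A}$, $M\in\mathcal{M}$ and formulas $\phi,\phi'$: (1) $\models[M]_a\mathsf{k}_a(M)$; (2) $\models[M]_a(\phi\rightarrow\phi')\rightarrow([M]_a\phi\rightarrow[M]_a\phi')$; (3) $\models[M]_a\phi\rightarrow(\mathsf{k}_a(M)\rightarrow\phi)$; (4) $\models\neg[M]_a\mathrm{false}$; (5) $\models[M]_a\phi\lor[M]_a\neg\phi$; (6) if $\models\phi$ then $\models[M]_a\phi$.
   Context: Let $\mathcal{A}$ be a non-empty finite set of agent names and $\mathcal{M}$ a set of message terms with $\mathcal{A}\subseteq\mathcal{M}$. Let $\mathcal{P}$ be a countable set of propositional variables containing, for every $a\in\mathcal{A}$, $M\in\mathcal{M}$, a distinguished atom $\mathsf{k}_a(M)$. Formulas: $\phi ::= P \mid \neg\phi \mid \phi\land\phi \mid [M]_a\phi$; abbreviations $\mathrm{true}:=[a]_a\mathsf{k}_a(a)$, $\mathrm{false}:=\neg\mathrm{true}$, $\lor,\rightarrow$ classical. An LDiiP-model consists of: a non-empty set $\mathcal{S}$ of states; for each $a\in\mathcal{A}$ a function $\mathrm{msgs}_a:\mathcal{S}\to\mathcal{P}(\mathcal{M})$ assigning a finite set of messages to each state and a compact closure operator $\mathrm{clo}_a$ on $\mathcal{P}(\mathcal{M})$, with $\mathrm{clo}_a^s(\emptyset):=\mathrm{clo}_a(\mathrm{msgs}_a(s))$; for each $M\in\mathcal{M}$, $a\in\mathcal{A}$ a relation $R_a^M\subseteq\mathcal{S}\times\mathcal{S}$ such that for all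 $s,s',s''$: there is $t$ with $sR_a^Mt$; if $sR_a^Ms'$ and $sR_a^Ms''$ then $s'=s''$; if $M\in\mathrm{clo}_a^s(\emptyset)$ then $sR_a^Ms$; if $sR_a^Ms'$ then $M\in\mathrm{clo}_a^{s'}(\emptyset)$; and a valuation $\mathcal{V}:\mathcal{P}\to\mathcal{P}(\mathcal{S})$ with $\mathcal{V}(\mathsf{k}_a(M))=\{s: M\in\mathrm{clo}_a^s(\emptyset)\}$. Satisfaction: $\mathfrak{M},s\models P$ iff $s\in\mathcal{V}(P)$; $\neg,\land$ classically; $\mathfrak{M},s\models[M]_a\phi$ iff for all $s'$ with $sR_a^Ms'$, $\mathfrak{M},s'\models\phi$. $\models\phi$ ($\phi$ is valid) means $\mathfrak{M},s\models\phi$ for every LDiiP-model $\mathfrak{M}$ and every state $s$ of it. -}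

module Defs where

open import Level using (0ℓ)
open import Data.Nat using (ℕ)
open import Data.Fin using (Fin)
open import Data.Product using (Σ; ∃; _×_; _,_)
open import Data.List using (List)
open import Data.List.Relation.Unary.All using (All)
import Data.List.Membership.Propositional as LMem
open import Relation.Unary using (Pred; _∈_; _⊆_)
open import Relation.Nullary using (¬_)
open import Relation.Binary.PropositionalEquality using (_≡_)
open import Function.Definitions using (Injective)

-- The parameters of the logic: agents 𝒜 (non-empty finite: Fin (suc n)),
-- messages ℳ with 𝒜 ⊆ ℳ (an injection), a countable set 𝒫 of atoms
-- (an injection into ℕ) containing distinguished (pairwise distinct)
-- atoms k_a(M).
record Signature : Set₁ where
  field
    n        : ℕ
    Msg      : Set
    agentMsg : Fin (Data.Nat.suc n) → Msg
    agentMsg-inj : Injective _≡_ _≡_ agentMsg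
    Atom     : Set
    encode   : Atom → ℕ
    encode-inj : Injective _≡_ _≡_ encode
    katom    : Fin (Data.Nat.suc n) → Msg → Atom
    katom-inj : ∀ {a b M N} → katom a M ≡ katom b N → (a ≡ b × M ≡ N)

  Agent : Set
  Agent = Fin (Data.Nat.suc n)

-- subsets of a set are predicates; finite subsets are given by lists
listSet : {A : Set} → List A → Pred A 0ℓ
listSet L x = LMem._∈_ x L

record IsCompactClosure {A : Set} (clo : Pred A 0ℓ → Pred A 0ℓ) : Set₁ where
  field
    extensive  : ∀ X → X ⊆ clo X
    monotone   : ∀ X Y → X ⊆ Y → clo X ⊆ clo Y
    idempotent : ∀ X → clo (clo X) ⊆ clo X
    compact    : ∀ X x → x ∈ clo X →
                 Σ (List A) (λ L → All (λ y → y ∈ X) L × x ∈ clo (listSet L))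

module LDiiP (Sg : Signature) where
  open Signature Sg public

  data Formula : Set where
    atom : Atom → Formula
    ¬'_  : Formula → Formula
    _∧'_ : Formula → Formula → Formula
    [_]_⟨_⟩ : Msg → Agent → Formula → Formula

  k' : Agent → Msg → Formula
  k' a M = atom (katom a M)

  _∨'_ : Formula → Formula → Formula
  φ ∨' ψ = ¬' ((¬' φ) ∧' (¬' ψ))

  _⇒'_ : Formula → Formula → Formula
  φ ⇒' ψ = ¬' (φ ∧' (¬' ψ))

  true' : Formula
  true' = [ agentMsg Data.Fin.zero ] Data.Fin.zero ⟨ k' Data.Fin.zero (agentMsg Data.Fin.zero) ⟩

  false' : Formula
  false' = ¬' true'

  record Model : Set₁ where
    field
      State  : Set
      inhabited : State
      msgs   : Agent → State → List Msg
      clo    : Agent → Pred Msg 0ℓ → Pred Msg 0ℓ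
      clo-compact : ∀ a → IsCompactClosure (clo a)
      R      : Msg → Agent → State → State → Set
      R-serial : ∀ M a s → ∃ λ t → R M a s t
      R-functional : ∀ M a s s' s'' → R M a s s' → R M a s s'' → s' ≡ s''
      R-refl : ∀ M a s → M ∈ clo a (listSet (msgs a s)) → R M a s s
      R-know : ∀ M a s s' → R M a s s' → M ∈ clo a (listSet (msgs a s'))
      V      : Atom → Pred State 0ℓ
      V-k₁   : ∀ a M s → s ∈ V (katom a M) → M ∈ clo a (listSet (msgs a s))
      V-k₂   : ∀ a M s → M ∈ clo a (listSet (msgs a s)) → s ∈ V (katom a M)

    clo∅ : Agent → State → Pred Msg 0ℓ
    clo∅ a s = clo a (listSet (msgs a s))

  open Model

  _,_⊨_ : (𝔐 : Model) → State 𝔐 → Formula → Set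
  𝔐 , s ⊨ atom P = s ∈ V 𝔐 P
  𝔐 , s ⊨ (¬' φ) = ¬ (𝔐 , s ⊨ φ)
  𝔐 , s ⊨ (φ ∧' ψ) = (𝔐 , s ⊨ φ) × (𝔐 , s ⊨ ψ)
  𝔐 , s ⊨ ([ M ] a ⟨ φ ⟩) = ∀ s' → R 𝔐 M a s s' → 𝔐 , s' ⊨ φ

  ⊨_ : Formula → Set₁
  ⊨ φ = ∀ (𝔐 : Model) (s : State 𝔐) → 𝔐 , s ⊨ φ

-- Each R_a^M is the graph of a total function s ↦ next s (seriality and
-- functionality), so [M]_a φ holds at s exactly when φ holds at next s.
-- Hence [M]_a commutes with the connectives, giving (2) and (5), and
-- [M]_a false fails, giving (4).  (1) says that R_a^M only reaches states
-- where M is known, and (3) is reflexivity of R_a^M at such states.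
module Submission where

open import Defs
open import Data.Product using (_×_; _,_; proj₁; proj₂)
open import Relation.Binary.PropositionalEquality using (subst)

module Semantics (Sg : Signature) where
  open LDiiP Sg
  open Model

  module _ (𝔐 : Model) (M : Msg) (a : Agent) where

    next : State 𝔐 → State 𝔐
    next s = proj₁ (R-serial 𝔐 M a s)

    R-next : ∀ s → R 𝔐 M a s (next s)
    R-next s = proj₂ (R-serial 𝔐 M a s)

    □-elim-next : ∀ {s} φ → 𝔐 , s ⊨ [ M ] a ⟨ φ ⟩ → 𝔐 , next s ⊨ φ
    □-elim-next {s} φ h = h (next s) (R-next s)

    □-intro-next : ∀ {s} φ → 𝔐 , next s ⊨ φ → 𝔐 , s ⊨ [ M ] a ⟨ φ ⟩
    □-intro-next {s} φ h t r =
      subst (λ u → 𝔐 , u ⊨ φ) (R-functional 𝔐 M a s (next s) t (R-next s) r) h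

  □-k : ∀ a M → ⊨ [ M ] a ⟨ k' a M ⟩
  □-k a M 𝔐 s t r = V-k₂ 𝔐 a M t (R-know 𝔐 M a s t r)

  □-distrib-⇒' : ∀ a M φ ψ →
    ⊨ ([ M ] a ⟨ φ ⇒' ψ ⟩ ⇒' ([ M ] a ⟨ φ ⟩ ⇒' [ M ] a ⟨ ψ ⟩))
  □-distrib-⇒' a M φ ψ 𝔐 s (□[φ⇒ψ] , ¬[□φ⇒□ψ]) = ¬[□φ⇒□ψ] λ (□φ , ¬□ψ) →
    □-elim-next 𝔐 M a (φ ⇒' ψ) □[φ⇒ψ]
      (□-elim-next 𝔐 M a φ □φ , λ ψ-next → ¬□ψ (□-intro-next 𝔐 M a ψ ψ-next))

  □-reflexive-on-k : ∀ a M φ → ⊨ ([ M ] a ⟨ φ ⟩ ⇒' (k' a M ⇒' φ))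
  □-reflexive-on-k a M φ 𝔐 s (□φ , ¬[k⇒φ]) =
    ¬[k⇒φ] λ (k , ¬φ) → ¬φ (□φ s (R-refl 𝔐 M a s (V-k₁ 𝔐 a M s k)))

  -- true' is itself an instance of □-k.
  ¬□-false' : ∀ a M → ⊨ ¬' [ M ] a ⟨ false' ⟩
  ¬□-false' a M 𝔐 s □false = □-elim-next 𝔐 M a false' □false (□-k _ _ 𝔐 (next 𝔐 M a s))

  □-excluded-middle : ∀ a M φ → ⊨ ([ M ] a ⟨ φ ⟩ ∨' [ M ] a ⟨ ¬' φ ⟩)
  □-excluded-middle a M φ 𝔐 s (¬□φ , ¬□¬φ) =
    ¬□¬φ (□-intro-next 𝔐 M a (¬' φ) λ φ-next → ¬□φ (□-intro-next 𝔐 M a φ φ-next))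

  □-necessitation : ∀ a M φ → ⊨ φ → ⊨ [ M ] a ⟨ φ ⟩
  □-necessitation a M φ ⊨φ 𝔐 s t r = ⊨φ 𝔐 t

proposition3 : (Sg : Signature) → let open LDiiP Sg in
    (a : Agent) (M : Msg) (φ φ' : Formula) →
    (⊨ ([ M ] a ⟨ k' a M ⟩))
    × (⊨ ([ M ] a ⟨ φ ⇒' φ' ⟩ ⇒' ([ M ] a ⟨ φ ⟩ ⇒' [ M ] a ⟨ φ' ⟩)))
    × (⊨ ([ M ] a ⟨ φ ⟩ ⇒' (k' a M ⇒' φ)))
    × (⊨ (¬' [ M ] a ⟨ false' ⟩))
    × (⊨ ([ M ] a ⟨ φ ⟩ ∨' [ M ] a ⟨ ¬' φ ⟩))
    × ((⊨ φ) → ⊨ [ M ] a ⟨ φ ⟩)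
proposition3 Sg a M φ φ' =
    □-k a M
  , □-distrib-⇒' a M φ φ'
  , □-reflexive-on-k a M φ
  , ¬□-false' a M
  , □-excluded-middle a M φ
  , □-necessitation a M φ
  where open Semantics Sg
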